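{- Let $H=T\cup C$ be a Halin graph whose accompanying cycle $C$ has edges ordered as $e_1,\ldots,e_p$, and run the parallel procedure $\mathrm{PLIST}(H)$ described in the context. Then every spanning tree of $H$ is output by $\mathrm{PLIST}(H)$ at least once.
   Context: A Halin graph $H=T\cup C$ is obtained from a tree $T$ (the characteristic tree) that has no vertex of degree two and at least three leaves, by adding a cycle $C$ (the accompanying cycle) through all leaves of $T$, in the cyclic order of a plane embedding of $T$. Let $p$ be the number of leaves and fix an ordering $e_1,\ldots,e_p$ of the edges of $C$. Procedure $\mathrm{PREC}(T',i)$, for a spanning tree $T'$ of $H$ and an index $i$: let $G^*=T'+e_i$ and let $C^*$ be the unique cycle of $G^*$ (it contains $e_i$); in parallel, for each edge $b\in E(C^*)\setminus E(C)$, let $T^*=G^*-b$, output $T^*$, and in parallel, for every $j=i+1,\ldots,p$, start a new processor executing $\mathrm{PREC}(T^*,j)$. Procedure $\mathrm{PLIST}(H)$ (on a CRCW PRAM): output $T$, then in parallel for every $i=1,\ldots,p$ start a new processor executing $\mathrm{PREC}(T,i)$. -}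

module Defs where

open import Level using (Level; 0ℓ) renaming (suc to lsuc)
open import Data.Nat using (ℕ; zero; suc; _≤_; _<_; _<?_; s≤s)
open import Data.Fin using (Fin; toℕ; fromℕ<) renaming (zero to fzero; _<_ to _<ᶠ_)
open import Data.Product using (Σ; ∃; _×_; _,_; proj₁; proj₂)
open import Data.Sum using (_⊎_)
open import Data.List using (List; length)
open import Data.List.Membership.Propositional using (_∈_)
open import Data.List.Relation.Unary.Unique.Propositional using (Unique)
open import Relation.Nullary using (¬_; yes; no)
open import Relation.Binary.PropositionalEquality using (_≡_)
open import Relation.Binary.Construct.Closure.ReflexiveTransitive using (Star)
open import Function.Bundles using (_⇔_)
open import Function.Definitions using (Injective)

-- Graphs on the vertex set Fin n, given by their (symmetric) edge relation.

EdgeSet : ℕ → Set₁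
EdgeSet n = Fin n → Fin n → Set

csuc : ∀ {m} → Fin m → Fin m
csuc {suc m} i with suc (toℕ i) <? suc m
... | yes lt = fromℕ< lt
... | no _   = fzero

iter : ∀ {A : Set} → (A → A) → ℕ → A → A
iter f zero    x = x
iter f (suc k) x = f (iter f k x)

SameEdge : ∀ {n} → Fin n × Fin n → Fin n × Fin n → Set
SameEdge (x , y) (u , v) = (x ≡ u × y ≡ v) ⊎ (x ≡ v × y ≡ u)

_+E_ : ∀ {n} → EdgeSet n → Fin n × Fin n → EdgeSet n
(G +E e) x y = G x y ⊎ SameEdge (x , y) e

_-E_ : ∀ {n} → EdgeSet n → Fin n × Fin n → EdgeSet n
(G -E e) x y = G x y × ¬ SameEdge (x , y) e

_⊆E_ : ∀ {n} → EdgeSet n → EdgeSet n → Set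
G ⊆E K = ∀ x y → G x y → K x y

_≐_ : ∀ {n} → EdgeSet n → EdgeSet n → Set
G ≐ K = ∀ x y → G x y ⇔ K x y

Symmetric : ∀ {n} → EdgeSet n → Set
Symmetric G = ∀ x y → G x y → G y x

Irreflexive : ∀ {n} → EdgeSet n → Set
Irreflexive G = ∀ x → ¬ G x x

Connected : ∀ {n} → EdgeSet n → Set
Connected G = ∀ x y → Star G x y

record Cycle {n} (G : EdgeSet n) : Set where
  field
    k     : ℕ
    c     : Fin (suc (suc (suc k))) → Fin n
    c-inj : Injective _≡_ _≡_ c
    adj   : ∀ i → G (c i) (c (csuc i))

Acyclic : ∀ {n} → EdgeSet n → Set
Acyclic G = ¬ Cycle G

OnCycle : ∀ {n} → EdgeSet n → Fin n × Fin n → Set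
OnCycle G e = Σ (Cycle G) λ Z → ∃ λ i → SameEdge (Cycle.c Z i , Cycle.c Z (csuc i)) e

-- a (spanning, since the vertex set is all of Fin n) tree
record IsTree {n} (G : EdgeSet n) : Set where
  field
    sym     : Symmetric G
    irrefl  : Irreflexive G
    conn    : Connected G
    acyclic : Acyclic G

SpanningTree : ∀ {n} → EdgeSet n → EdgeSet n → Set
SpanningTree H S = S ⊆E H × IsTree S

Degree : ∀ {n} → EdgeSet n → Fin n → ℕ → Set
Degree {n} G v d = Σ (List (Fin n)) λ xs →
  Unique xs × (∀ w → (w ∈ xs) ⇔ G v w) × length xs ≡ d

Leaf : ∀ {n} → EdgeSet n → Fin n → Set
Leaf G v = Degree G v 1

-- Plane embeddings of a tree as rotation systems.
-- ρ v is a cyclic permutation of the neighbours of v.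

Rotation : ∀ {n} → EdgeSet n → (Fin n → Fin n → Fin n) → Set
Rotation G ρ = ∀ v →
  (∀ u → G v u → G v (ρ v u)) ×
  (∀ u w → G v u → G v w → ∃ λ k → iter (ρ v) k u ≡ w)

-- face-tracing step on darts: (u,v) ↦ (v, ρ v u)
step : ∀ {n} → (Fin n → Fin n → Fin n) → Fin n × Fin n → Fin n × Fin n
step ρ (u , v) = (v , ρ v u)

-- ℓ' is the first leaf reached when tracing the (unique) face of the embedded
-- tree starting with the dart leaving the leaf ℓ
NextLeaf : ∀ {n} → EdgeSet n → (Fin n → Fin n → Fin n) → Fin n → Fin n → Set
NextLeaf G ρ ℓ ℓ' = Σ _ λ a → G ℓ a × ∃ λ m →
  proj₂ (iter (step ρ) m (ℓ , a)) ≡ ℓ' ×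
  (∀ j → j < m → ¬ Leaf G (proj₂ (iter (step ρ) j (ℓ , a))))

-- Halin graphs H = T ∪ C on Fin n with p leaves.
-- leaf 0, leaf 1, …, leaf (p-1) lists the leaves of T in the cyclic order
-- of a plane embedding ρ of T; C is the cycle through them in that order.

record Halin (n p : ℕ) : Set₁ where
  field
    T         : EdgeSet n
    T-tree    : IsTree T
    noDeg2    : ∀ v → ¬ Degree T v 2
    threeLeaves : 3 ≤ p
    leaf      : Fin p → Fin n
    leaf-inj  : Injective _≡_ _≡_ leaf
    leaf-leaf : ∀ k → Leaf T (leaf k)
    leaf-all  : ∀ v → Leaf T v → ∃ λ k → leaf k ≡ v
    ρ         : Fin n → Fin n → Fin n
    ρ-rot     : Rotation T ρ
    plane     : ∀ k → NextLeaf T ρ (leaf k) (leaf (csuc k))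

  C : EdgeSet n
  C x y = ∃ λ k → SameEdge (x , y) (leaf k , leaf (csuc k))

  H : EdgeSet n
  H x y = T x y ⊎ C x y

-- The edges of C are ordered
-- e_i = {leaf (ord i), leaf (ord i + 1)} for i : Fin p, ord a bijection.
-- PRECOut T' i X : X is output by (some processor spawned by) PREC(T', i).

module Procedure {n p : ℕ} (𝓗 : Halin n p) (ord : Fin p → Fin p) where
  open Halin 𝓗

  e : Fin p → Fin n × Fin n
  e i = (leaf (ord i) , leaf (csuc (ord i)))

  data PRECOut (T' : EdgeSet n) (i : Fin p) : EdgeSet n → Set₁ where
    out : ∀ b → OnCycle (T' +E e i) b → ¬ C (proj₁ b) (proj₂ b) →
          PRECOut T' i ((T' +E e i) -E b)
    rec : ∀ b → OnCycle (T' +E e i) b → ¬ C (proj₁ b) (proj₂ b) →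
          ∀ j → i <ᶠ j → ∀ {X} → PRECOut ((T' +E e i) -E b) j X →
          PRECOut T' i X

  PLISTOut : EdgeSet n → Set₁
  PLISTOut X = X ≡ T ⊎ ∃ λ i → PRECOut T i X

module Submission where

-- Fix a spanning tree S of H and go through e₁, …, e_p in order, keeping a
-- spanning tree G from which PLIST proceeds (initially G = T).  Before step i,
-- every edge of S off C lies in G, every C-edge of G lies in S, and every
-- e_j ∈ S with j < i lies in G.  If e_i ∈ S ∖ G, the cycle of G + e_i has an
-- edge b ∉ S (S is acyclic), and b ∉ C by the invariant, so PREC(G, i) outputs
-- the spanning tree G + e_i − b, which satisfies the invariant for i + 1, and
-- the recursive calls PREC(·, j), j > i, take over.  After step p we have
-- S ⊆ G, and a spanning tree inside another one equals it.  The invariant holds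
-- for T because consecutive leaves are never adjacent in T (as p ≥ 3).

open import Defs
open import Data.Empty using (⊥-elim)
open import Data.Fin using (Fin; toℕ; fromℕ; fromℕ<; inject₁; _≟_)
  renaming (zero to fzero; suc to fsuc)
import Data.Fin.Properties as Finₚ
open import Data.List using (List; []; _∷_)
open import Data.List.Membership.Propositional using (_∈_)
import Data.List.Membership.DecPropositional as DecMembership
open import Data.List.Relation.Unary.All as All using ()
open import Data.List.Relation.Unary.All.Properties using (¬Any⇒All¬)
open import Data.List.Relation.Unary.AllPairs using ([]; _∷_)
open import Data.List.Relation.Unary.Any using (here; there)
open import Data.List.Relation.Unary.Unique.Propositional using (Unique)
open import Data.Nat using (ℕ; zero; suc; _+_; _∸_; _%_; _≤_; _<_; _<?_; z≤n; s≤s)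
open import Data.Nat.DivMod
open import Data.Nat.Properties hiding (_≟_)
open import Function using (_∘_)
open import Function.Bundles using (Equivalence; mk⇔)
open import Function.Definitions using (Bijective; Surjective)
open import Data.Product using (Σ; ∃; _×_; _,_; proj₁; proj₂; uncurry)
open import Data.Sum using (_⊎_; inj₁; inj₂; fromInj₁)
open import Relation.Binary.Construct.Closure.ReflexiveTransitive as Star
  using (Star; ε; _◅_; _◅◅_; _>>=_)
open import Relation.Binary.PropositionalEquality
open import Relation.Nullary using (¬_; Dec; yes; no)
open import Relation.Nullary.Decidable using (_×-dec_; _⊎-dec_)

toℕ-csuc : ∀ {m} (i : Fin (suc m)) → toℕ (csuc i) ≡ suc (toℕ i) % suc m
toℕ-csuc {m} i with suc (toℕ i) <? suc m
... | yes i+1<m = trans (Finₚ.toℕ-fromℕ< i+1<m) (sym (m<n⇒m%n≡m i+1<m))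
... | no  i+1≮m = sym (trans (cong (_% suc m) i+1≡m) (n%n≡0 (suc m)))
  where
  i+1≡m : suc (toℕ i) ≡ suc m
  i+1≡m = ≤-antisym (Finₚ.toℕ<n i) (≮⇒≥ i+1≮m)

toℕ-iter-csuc : ∀ {m} (i : Fin (suc m)) s → toℕ (iter csuc s i) ≡ (toℕ i + s) % suc m
toℕ-iter-csuc {m} i zero =
  sym (trans (cong (_% suc m) (+-identityʳ (toℕ i))) (m<n⇒m%n≡m (Finₚ.toℕ<n i)))
toℕ-iter-csuc {m} i (suc s) = begin
  toℕ (csuc (iter csuc s i))          ≡⟨ toℕ-csuc (iter csuc s i) ⟩
  suc (toℕ (iter csuc s i)) % suc m   ≡⟨ cong (λ a → suc a % suc m) (toℕ-iter-csuc i s) ⟩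
  (1 + (toℕ i + s) % suc m) % suc m   ≡⟨ %-distribˡ-+ 1 ((toℕ i + s) % suc m) (suc m) ⟩
  (1 % suc m + (toℕ i + s) % suc m % suc m) % suc m
      ≡⟨ cong (λ a → (1 % suc m + a) % suc m) (m%n%n≡m%n (toℕ i + s) (suc m)) ⟩
  (1 % suc m + (toℕ i + s) % suc m) % suc m ≡⟨ sym (%-distribˡ-+ 1 (toℕ i + s) (suc m)) ⟩
  suc (toℕ i + s) % suc m             ≡⟨ cong (_% suc m) (sym (+-suc (toℕ i) s)) ⟩
  (toℕ i + suc s) % suc m             ∎
  where open ≡-Reasoning

iter-csuc-period : ∀ {m} (i : Fin (suc m)) → iter csuc (suc m) i ≡ i
iter-csuc-period {m} i = Finₚ.toℕ-injective (begin
  toℕ (iter csuc (suc m) i) ≡⟨ toℕ-iter-csuc i (suc m) ⟩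
  (toℕ i + suc m) % suc m   ≡⟨ [m+n]%n≡m%n (toℕ i) (suc m) ⟩
  toℕ i % suc m             ≡⟨ m<n⇒m%n≡m (Finₚ.toℕ<n i) ⟩
  toℕ i                     ∎)
  where open ≡-Reasoning

iter-csuc-≢ : ∀ {m} (i : Fin m) {s} → 0 < s → s < m → iter csuc s i ≢ i
iter-csuc-≢ {suc m} i {s} 0<s s<m iterᵢ≡i with toℕ i + s <? suc m
... | yes i+s<m = <-irrefl (sym (trans (sym (m<n⇒m%n≡m i+s<m)) i+s%m≡i)) (m<m+n (toℕ i) 0<s)
  where
  i+s%m≡i : (toℕ i + s) % suc m ≡ toℕ i
  i+s%m≡i = trans (sym (toℕ-iter-csuc i s)) (cong toℕ iterᵢ≡i)
... | no  i+s≮m = <-irrefl wrapped≡i wrapped<i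
  where
  m≤i+s = ≮⇒≥ i+s≮m
  -- after wrapping around once, the index is i + s - m, which is below i since s < m
  wrapped<i : toℕ i + s ∸ suc m < toℕ i
  wrapped<i = subst (toℕ i + s ∸ suc m <_) (m+n∸n≡m (toℕ i) (suc m))
                (∸-monoˡ-< (+-monoʳ-< (toℕ i) s<m) m≤i+s)
  wrapped≡i : toℕ i + s ∸ suc m ≡ toℕ i
  wrapped≡i = begin
    toℕ i + s ∸ suc m            ≡⟨ sym (m<n⇒m%n≡m (<-trans wrapped<i (Finₚ.toℕ<n i))) ⟩
    (toℕ i + s ∸ suc m) % suc m  ≡⟨ m≤n⇒[n∸m]%m≡n%m m≤i+s ⟩
    (toℕ i + s) % suc m          ≡⟨ sym (toℕ-iter-csuc i s) ⟩
    toℕ (iter csuc s i)          ≡⟨ cong toℕ iterᵢ≡i ⟩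
    toℕ i                        ∎
    where open ≡-Reasoning

csuc-inject₁ : ∀ {m} (j : Fin m) → csuc (inject₁ j) ≡ fsuc j
csuc-inject₁ {m} j = Finₚ.toℕ-injective (begin
  toℕ (csuc (inject₁ j))        ≡⟨ toℕ-csuc (inject₁ j) ⟩
  suc (toℕ (inject₁ j)) % suc m ≡⟨ cong (λ a → suc a % suc m) (Finₚ.toℕ-inject₁ j) ⟩
  suc (toℕ j) % suc m           ≡⟨ m<n⇒m%n≡m (s≤s (Finₚ.toℕ<n j)) ⟩
  suc (toℕ j)                   ∎)
  where open ≡-Reasoning

csuc-fromℕ : ∀ m → csuc (fromℕ m) ≡ fzero
csuc-fromℕ m = Finₚ.toℕ-injective (begin
  toℕ (csuc (fromℕ m))        ≡⟨ toℕ-csuc (fromℕ m) ⟩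
  suc (toℕ (fromℕ m)) % suc m ≡⟨ cong (λ a → suc a % suc m) (Finₚ.toℕ-fromℕ m) ⟩
  suc m % suc m               ≡⟨ n%n≡0 (suc m) ⟩
  0                           ∎)
  where open ≡-Reasoning

data LastView : ∀ {m} → Fin (suc m) → Set where
  last  : ∀ {m} → LastView (fromℕ m)
  inner : ∀ {m} (j : Fin m) → LastView (inject₁ j)

lastView : ∀ {m} (i : Fin (suc m)) → LastView i
lastView {zero}  fzero    = last
lastView {suc m} fzero    = inner fzero
lastView {suc m} (fsuc i) with lastView i
... | last    = last
... | inner j = inner (fsuc j)

module _ {n : ℕ} where

  SameEdge-refl : {e : Fin n × Fin n} → SameEdge e e
  SameEdge-refl = inj₁ (refl , refl)

  SameEdge-sym : {e f : Fin n × Fin n} → SameEdge e f → SameEdge f e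
  SameEdge-sym (inj₁ (refl , refl)) = inj₁ (refl , refl)
  SameEdge-sym (inj₂ (refl , refl)) = inj₂ (refl , refl)

  SameEdge-trans : {e f g : Fin n × Fin n} → SameEdge e f → SameEdge f g → SameEdge e g
  SameEdge-trans (inj₁ (refl , refl)) ef = ef
  SameEdge-trans (inj₂ (refl , refl)) (inj₁ (refl , refl)) = inj₂ (refl , refl)
  SameEdge-trans (inj₂ (refl , refl)) (inj₂ (refl , refl)) = inj₁ (refl , refl)

  SameEdge-flip : ∀ {x y : Fin n} {e} → SameEdge (x , y) e → SameEdge (y , x) e
  SameEdge-flip (inj₁ (refl , refl)) = inj₂ (refl , refl)
  SameEdge-flip (inj₂ (refl , refl)) = inj₁ (refl , refl)

  SameEdge? : (e f : Fin n × Fin n) → Dec (SameEdge e f)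
  SameEdge? (x , y) (u , v) = ((x ≟ u) ×-dec (y ≟ v)) ⊎-dec ((x ≟ v) ×-dec (y ≟ u))

  loop-SameEdge : ∀ {a x y : Fin n} → SameEdge (a , a) (x , y) → x ≡ y
  loop-SameEdge (inj₁ (refl , refl)) = refl
  loop-SameEdge (inj₂ (refl , refl)) = refl

  resp-SameEdge : ∀ {Q : EdgeSet n} → Symmetric Q →
                  ∀ {s t x y} → SameEdge (s , t) (x , y) → Q x y → Q s t
  resp-SameEdge sym (inj₁ (refl , refl)) q = q
  resp-SameEdge sym (inj₂ (refl , refl)) q = sym _ _ q

  Star-symmetric : ∀ {G : EdgeSet n} → Symmetric G → Symmetric (Star G)
  Star-symmetric sym _ _ = Star.reverse (sym _ _)

  +E-symmetric : ∀ {G : EdgeSet n} {e} → Symmetric G → Symmetric (G +E e)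
  +E-symmetric sym x y (inj₁ g)  = inj₁ (sym x y g)
  +E-symmetric sym x y (inj₂ se) = inj₂ (SameEdge-flip se)

  -E-symmetric : ∀ {G : EdgeSet n} {e} → Symmetric G → Symmetric (G -E e)
  -E-symmetric sym x y (g , ¬se) = sym x y g , λ se → ¬se (SameEdge-flip se)

  +E-irreflexive : ∀ {G : EdgeSet n} {x y} → Irreflexive G → x ≢ y → Irreflexive (G +E (x , y))
  +E-irreflexive irr x≢y a (inj₁ g)  = irr a g
  +E-irreflexive irr x≢y a (inj₂ se) = x≢y (loop-SameEdge se)

module _ {n : ℕ} {R : EdgeSet n} where

  vertices : ∀ {x y} → Star R x y → List (Fin n)
  vertices {x} ε       = x ∷ []
  vertices {x} (_ ◅ w) = x ∷ vertices w

  steps : ∀ {x y} → Star R x y → ℕ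
  steps ε       = 0
  steps (_ ◅ w) = suc (steps w)

  vertex : ∀ {x y} (w : Star R x y) → Fin (suc (steps w)) → Fin n
  vertex {x} w       fzero    = x
  vertex     (_ ◅ w) (fsuc i) = vertex w i

  vertex-∈ : ∀ {x y} (w : Star R x y) i → vertex w i ∈ vertices w
  vertex-∈ ε       fzero    = here refl
  vertex-∈ (_ ◅ w) fzero    = here refl
  vertex-∈ (_ ◅ w) (fsuc i) = there (vertex-∈ w i)

  vertex-injective : ∀ {x y} (w : Star R x y) → Unique (vertices w) →
                     ∀ {i j} → vertex w i ≡ vertex w j → i ≡ j
  vertex-injective ε       _        {fzero}  {fzero}  _  = refl
  vertex-injective (_ ◅ w) _        {fzero}  {fzero}  _  = refl
  vertex-injective (_ ◅ w) (x∉ ∷ _) {fzero}  {fsuc j} eq = ⊥-elim (All.lookup x∉ (vertex-∈ w j) eq)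
  vertex-injective (_ ◅ w) (x∉ ∷ _) {fsuc i} {fzero}  eq =
    ⊥-elim (All.lookup x∉ (vertex-∈ w i) (sym eq))
  vertex-injective (_ ◅ w) (_ ∷ u)  {fsuc i} {fsuc j} eq = cong fsuc (vertex-injective w u eq)

  vertex-step : ∀ {x y} (w : Star R x y) (j : Fin (steps w)) →
                R (vertex w (inject₁ j)) (vertex w (fsuc j))
  vertex-step (r ◅ w) fzero    = r
  vertex-step (_ ◅ w) (fsuc j) = vertex-step w j

  vertex-last : ∀ {x y} (w : Star R x y) → vertex w (fromℕ (steps w)) ≡ y
  vertex-last ε       = refl
  vertex-last (_ ◅ w) = vertex-last w

  Path : Fin n → Fin n → Set
  Path x y = Σ (Star R x y) λ w → Unique (vertices w)

  suffix : ∀ {x z y} (w : Star R z y) → x ∈ vertices w → Unique (vertices w) → Path x y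
  suffix ε       (here refl) u       = ε , u
  suffix (r ◅ w) (here refl) u       = r ◅ w , u
  suffix (_ ◅ w) (there x∈w) (_ ∷ u) = suffix w x∈w u

  toPath : ∀ {x y} → Star R x y → Path x y
  toPath ε = ε , All.[] ∷ []
  toPath {x} (r ◅ w) with toPath w
  ... | w′ , u with DecMembership._∈?_ _≟_ x (vertices w′)
  ...   | yes x∈w′ = suffix w′ x∈w′ u
  ...   | no  x∉w′ = r ◅ w′ , ¬Any⇒All¬ (vertices w′) x∉w′ ∷ u

  close-path : ∀ {G : EdgeSet n} {x z₁ z₂ y} → R ⊆E G →
               (r₁ : R x z₁) (r₂ : R z₁ z₂) (w : Star R z₂ y) →
               Unique (vertices (r₁ ◅ r₂ ◅ w)) → G y x → Cycle G
  close-path {G} R⊆G r₁ r₂ w u closing = record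
    { k = steps w ; c = vertex p ; c-inj = vertex-injective p u ; adj = adj }
    where
    p = r₁ ◅ r₂ ◅ w
    adj : ∀ i → G (vertex p i) (vertex p (csuc i))
    adj i with lastView i
    ... | last    = subst₂ G (sym (vertex-last p)) (cong (vertex p) (sym (csuc-fromℕ (steps p))))
                           closing
    ... | inner j = subst (G (vertex p (inject₁ j)) ∘ vertex p) (sym (csuc-inject₁ j))
                          (R⊆G _ _ (vertex-step p j))

module _ {n : ℕ} {G : EdgeSet n} (Z : Cycle G) where
  open Cycle Z

  cycle-edge : Fin (suc (suc (suc k))) → Fin n × Fin n
  cycle-edge i = c i , c (csuc i)

  cycle-edge-injective : ∀ {r i} → SameEdge (cycle-edge r) (cycle-edge i) → r ≡ i
  cycle-edge-injective (inj₁ (cr≡ci , _)) = c-inj cr≡ci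
  cycle-edge-injective {r} {i} (inj₂ (cr≡ci+1 , cr+1≡ci)) =
    ⊥-elim (iter-csuc-≢ i (s≤s z≤n) (s≤s (s≤s (s≤s z≤n)))
             (trans (cong csuc (sym (c-inj cr≡ci+1))) (c-inj cr+1≡ci)))

  cycle-edge-detour : ∀ i → Star (G -E cycle-edge i) (c (csuc i)) (c i)
  cycle-edge-detour i = subst (Star (G -E cycle-edge i) (c (csuc i)) ∘ c) (iter-csuc-period i)
                          (forward (suc (suc k)) ≤-refl)
    where
    forward : ∀ d → d < suc (suc (suc k)) →
              Star (G -E cycle-edge i) (c (csuc i)) (c (iter csuc (suc d) i))
    forward zero    _   = ε
    forward (suc d) d<m = forward d (<-trans (n<1+n d) d<m) ◅◅
      (adj r , λ se → iter-csuc-≢ i (s≤s z≤n) d<m (cycle-edge-injective se)) ◅ ε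
      where r = iter csuc (suc d) i

  cycle-in : ∀ {K : EdgeSet n} → (∀ i → K (c i) (c (csuc i))) → Cycle K
  cycle-in edges = record { k = k ; c = c ; c-inj = c-inj ; adj = edges }

module _ {n : ℕ} where

  cycle-edge-removal-connected : ∀ {G : EdgeSet n} → Symmetric G → Connected G →
                                 (Z : Cycle G) → ∀ i → Connected (G -E cycle-edge Z i)
  cycle-edge-removal-connected {G} sym conn Z i a d = conn a d >>= reroute
    where
    sym⁻ = Star-symmetric (-E-symmetric sym)
    reroute : ∀ {s t} → G s t → Star (G -E cycle-edge Z i) s t
    reroute {s} {t} g with SameEdge? (s , t) (cycle-edge Z i)
    ... | yes se = resp-SameEdge sym⁻ se (sym⁻ _ _ (cycle-edge-detour Z i))
    ... | no ¬se = (g , ¬se) ◅ ε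

  acyclic-bridge : ∀ {G : EdgeSet n} → Symmetric G → Irreflexive G → Acyclic G →
                   ∀ {u v} → G u v → ¬ Star (G -E (u , v)) u v
  acyclic-bridge sym irr acyc {u} {v} g w with toPath w
  ... | ε , _               = irr u g
  ... | r ◅ ε , _           = proj₂ r SameEdge-refl
  ... | r₁ ◅ r₂ ◅ w′ , uniq = acyc (close-path (λ _ _ → proj₁) r₁ r₂ w′ uniq (sym u v g))

  tree-adjacent? : ∀ {G : EdgeSet n} → IsTree G → ∀ x y → Dec (G x y)
  tree-adjacent? tG x y with toPath (IsTree.conn tG x y)
  ... | ε , _              = no (IsTree.irrefl tG x)
  ... | r ◅ ε , _          = yes r
  ... | r₁ ◅ r₂ ◅ w , uniq =
    no λ g → IsTree.acyclic tG (close-path (λ _ _ g → g) r₁ r₂ w uniq (IsTree.sym tG x y g))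

  fundamental-cycle : ∀ {G : EdgeSet n} → IsTree G →
                      ∀ {x y} → x ≢ y → ¬ G x y → Cycle (G +E (x , y))
  fundamental-cycle tG {x} {y} x≢y ¬g with toPath (IsTree.conn tG x y)
  ... | ε , _              = ⊥-elim (x≢y refl)
  ... | r ◅ ε , _          = ⊥-elim (¬g r)
  ... | r₁ ◅ r₂ ◅ w , uniq = close-path (λ _ _ → inj₁) r₁ r₂ w uniq (inj₂ (inj₂ (refl , refl)))

  tree-⊆⇒⊇ : ∀ {G S : EdgeSet n} → IsTree G → IsTree S → S ⊆E G → G ⊆E S
  tree-⊆⇒⊇ {G} {S} tG tS S⊆G a d g with tree-adjacent? tS a d
  ... | yes s = s
  ... | no ¬s = ⊥-elim (acyclic-bridge (IsTree.sym tG) (IsTree.irrefl tG) (IsTree.acyclic tG) g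
                          (Star.map avoid (IsTree.conn tS a d)))
    where
    avoid : ∀ {s t} → S s t → (G -E (a , d)) s t
    avoid {s} {t} st = S⊆G s t st , λ se → ¬s (resp-SameEdge (IsTree.sym tS) (SameEdge-sym se) st)

module _ {n : ℕ} {G : EdgeSet n} (tG : IsTree G) {x y : Fin n} (x≢y : x ≢ y)
         (Z : Cycle (G +E (x , y))) (i : Fin (suc (suc (suc (Cycle.k Z))))) where
  open IsTree tG renaming (sym to G-sym)

  private
    G⁺ G′ G⁻ : EdgeSet n
    G⁺ = G +E (x , y)
    G′ = G⁺ -E cycle-edge Z i
    G⁻ = G -E cycle-edge Z i

  -- A cycle of G′ must use xy (otherwise it lies in G), so x and y are joined in
  -- G⁻; rerouting the detour of b = cycle-edge Z i through that walk shows that b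
  -- would not be a bridge of the tree G.
  exchange-acyclic : uncurry G (cycle-edge Z i) → Acyclic G′
  exchange-acyclic Gb Z′ with Finₚ.any? (λ j → SameEdge? (cycle-edge Z′ j) (x , y))
  ... | no avoids-xy = acyclic (cycle-in Z′ in-G)
    where
    in-G : ∀ j → G (Cycle.c Z′ j) (Cycle.c Z′ (csuc j))
    in-G j with Cycle.adj Z′ j
    ... | inj₁ g , _ = g
    ... | inj₂ se , _ = ⊥-elim (avoids-xy (j , se))
  ... | yes (j , se-xy) = acyclic-bridge G-sym irrefl acyclic Gb
                            (G⁻-sym⋆ _ _ (cycle-edge-detour Z i >>= via-x⇝y))
    where
    G⁻-sym⋆ = Star-symmetric (-E-symmetric G-sym)
    to-G⁻ : ∀ {s t} → (G′ -E cycle-edge Z′ j) s t → G⁻ s t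
    to-G⁻ ((inj₁ g , ¬b) , _)    = g , ¬b
    to-G⁻ ((inj₂ se , _) , ¬se) = ⊥-elim (¬se (SameEdge-trans se (SameEdge-sym se-xy)))
    x⇝y : Star G⁻ x y
    x⇝y = resp-SameEdge G⁻-sym⋆ (SameEdge-sym se-xy)
            (G⁻-sym⋆ _ _ (Star.map to-G⁻ (cycle-edge-detour Z′ j)))
    via-x⇝y : ∀ {s t} → G′ s t → Star G⁻ s t
    via-x⇝y (inj₁ g , ¬b)  = (g , ¬b) ◅ ε
    via-x⇝y (inj₂ se , _) = resp-SameEdge G⁻-sym⋆ se x⇝y

  exchange-tree : uncurry G (cycle-edge Z i) → IsTree G′
  exchange-tree Gb = record
    { sym     = -E-symmetric (+E-symmetric G-sym)
    ; irrefl  = λ a → +E-irreflexive {G = G} irrefl x≢y a ∘ proj₁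
    ; conn    = cycle-edge-removal-connected (+E-symmetric G-sym)
                  (λ a b → Star.map inj₁ (conn a b)) Z i
    ; acyclic = exchange-acyclic Gb
    }

exchange : ∀ {n} {G S : EdgeSet n} → IsTree G → IsTree S → ∀ {x y} → ¬ G x y → S x y →
           ∃ λ b → OnCycle (G +E (x , y)) b × ¬ uncurry S b × uncurry G b ×
                   IsTree ((G +E (x , y)) -E b)
exchange {G = G} {S} tG tS {x} {y} ¬g s =
  cycle-edge Z i , (Z , i , SameEdge-refl) , ¬Sb , Gb , exchange-tree tG x≢y Z i Gb
  where
  x≢y : x ≢ y
  x≢y refl = IsTree.irrefl tS x s
  Z = fundamental-cycle tG x≢y ¬g
  ∃¬Sb = Finₚ.¬∀⟶∃¬ _ (uncurry S ∘ cycle-edge Z) (λ _ → tree-adjacent? tS _ _)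
           (IsTree.acyclic tS ∘ cycle-in Z)
  i = proj₁ ∃¬Sb
  ¬Sb = proj₂ ∃¬Sb
  Gb : uncurry G (cycle-edge Z i)
  Gb with Cycle.adj Z i
  ... | inj₁ g  = g
  ... | inj₂ se = ⊥-elim (¬Sb (resp-SameEdge (IsTree.sym tS) se s))

module _ {n : ℕ} {G : EdgeSet n} where

  leaf-neighbour-unique : ∀ {v a b} → Leaf G v → G v a → G v b → a ≡ b
  leaf-neighbour-unique (_ ∷ [] , _ , nbrs , _) ga gb
    with Equivalence.from (nbrs _) ga | Equivalence.from (nbrs _) gb
  ... | here refl | here refl = refl

  adjacent-leaves-isolated : Symmetric G → ∀ {u v} → Leaf G u → Leaf G v → G u v →
                             ∀ {a z} → a ≡ u ⊎ a ≡ v → Star G a z → z ≡ u ⊎ z ≡ v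
  adjacent-leaves-isolated sym ℓu ℓv guv a∈uv          ε       = a∈uv
  adjacent-leaves-isolated sym ℓu ℓv guv (inj₁ refl) (g ◅ w) =
    adjacent-leaves-isolated sym ℓu ℓv guv (inj₂ (leaf-neighbour-unique ℓu g guv)) w
  adjacent-leaves-isolated sym ℓu ℓv guv (inj₂ refl) (g ◅ w) =
    adjacent-leaves-isolated sym ℓu ℓv guv (inj₁ (leaf-neighbour-unique ℓv g (sym _ _ guv))) w

module _ {n p : ℕ} (𝓗 : Halin n p) where
  open Halin 𝓗

  consecutive-leaves-nonadjacent : ∀ k → ¬ T (leaf k) (leaf (csuc k))
  consecutive-leaves-nonadjacent k t
    with adjacent-leaves-isolated (IsTree.sym T-tree) (leaf-leaf k) (leaf-leaf (csuc k)) t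
           (inj₁ refl) (IsTree.conn T-tree _ (leaf (csuc (csuc k))))
  ... | inj₁ eq = iter-csuc-≢ k (s≤s z≤n) threeLeaves (leaf-inj eq)
  ... | inj₂ eq = iter-csuc-≢ (csuc k) (s≤s z≤n) (≤-trans (s≤s (s≤s z≤n)) threeLeaves) (leaf-inj eq)

  T∩C-empty : ∀ {x y} → T x y → ¬ C x y
  T∩C-empty t (k , se) =
    consecutive-leaves-nonadjacent k (resp-SameEdge (IsTree.sym T-tree) (SameEdge-sym se) t)

  C? : ∀ x y → Dec (C x y)
  C? x y = Finₚ.any? λ k → SameEdge? (x , y) (leaf k , leaf (csuc k))

module Sweep {n p : ℕ} (𝓗 : Halin n p) (ord : Fin p → Fin p) (ord-onto : Surjective _≡_ _≡_ ord)
             {S : EdgeSet n} (S⊆H : S ⊆E Halin.H 𝓗) (tS : IsTree S) where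
  open Halin 𝓗
  open Procedure 𝓗 ord

  record Invariant (G : EdgeSet n) (t : ℕ) : Set where
    field
      tree    : IsTree G
      C∩G⊆S   : ∀ x y → G x y → C x y → S x y
      S∖C⊆G   : ∀ x y → S x y → ¬ C x y → G x y
      settled : ∀ i → toℕ i < t → uncurry S (e i) → uncurry G (e i)
  open Invariant

  Reaches : EdgeSet n → ℕ → Set₁
  Reaches G t = G ≐ S ⊎ ∃ λ X → ∃ λ i → t ≤ toℕ i × PRECOut G i X × X ≐ S

  start : Invariant T 0
  start = record
    { tree    = T-tree
    ; C∩G⊆S   = λ _ _ t c → ⊥-elim (T∩C-empty 𝓗 t c)
    ; S∖C⊆G   = λ x y s ¬c → fromInj₁ (⊥-elim ∘ ¬c) (S⊆H x y s)
    ; settled = λ _ ()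
    }

  S⊆G-at-end : ∀ {G} → Invariant G p → S ⊆E G
  S⊆G-at-end inv x y s with C? 𝓗 x y
  ... | no ¬c = S∖C⊆G inv x y s ¬c
  ... | yes (k , se) with ord-onto k
  ...   | i , ord⁻ with ord⁻ refl
  ...     | refl = resp-SameEdge (IsTree.sym (tree inv)) se
                     (settled inv i (Finₚ.toℕ<n i)
                        (resp-SameEdge (IsTree.sym tS) (SameEdge-sym se) s))

  G≐S-at-end : ∀ {G} → Invariant G p → G ≐ S
  G≐S-at-end inv x y = mk⇔ (tree-⊆⇒⊇ (tree inv) tS (S⊆G-at-end inv) x y) (S⊆G-at-end inv x y)

  extend-settled : ∀ {P : Fin p → Set} i → (∀ j → toℕ j < toℕ i → P j) → P i →
                   ∀ j → toℕ j < suc (toℕ i) → P j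
  extend-settled i below at j j<i+1 with m<1+n⇒m<n∨m≡n j<i+1
  ... | inj₁ j<i = below j j<i
  ... | inj₂ j≡i rewrite Finₚ.toℕ-injective j≡i = at

  settle-unchanged : ∀ {G} i → Invariant G (toℕ i) → (uncurry S (e i) → uncurry G (e i)) →
                     Invariant G (suc (toℕ i))
  settle-unchanged i inv settles = record
    { tree = tree inv ; C∩G⊆S = C∩G⊆S inv ; S∖C⊆G = S∖C⊆G inv
    ; settled = extend-settled i (settled inv) settles }

  Reaches-weaken : ∀ {G t} → Reaches G (suc t) → Reaches G t
  Reaches-weaken (inj₁ G≐S)                        = inj₁ G≐S
  Reaches-weaken (inj₂ (X , j , t<j , run , X≐S)) = inj₂ (X , j , <⇒≤ t<j , run , X≐S)

  advance : ∀ {G t} → Invariant G t → (i : Fin p) → toℕ i ≡ t →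
            Σ (EdgeSet n) λ G′ → Invariant G′ (suc t) × (Reaches G′ (suc t) → Reaches G t)
  advance {G} inv i refl with tree-adjacent? tS (proj₁ (e i)) (proj₂ (e i))
                            | tree-adjacent? (tree inv) (proj₁ (e i)) (proj₂ (e i))
  ... | no ¬s | _     = G , settle-unchanged i inv (⊥-elim ∘ ¬s) , Reaches-weaken
  ... | yes _ | yes g = G , settle-unchanged i inv (λ _ → g) , Reaches-weaken
  ... | yes s | no ¬g with exchange (tree inv) tS ¬g s
  ...   | b , b-on-cycle , ¬Sb , Gb , tree′ = G′ , inv′ , found
    where
    G′ = (G +E e i) -E b
    ¬Cb : ¬ uncurry C b
    ¬Cb c = ¬Sb (C∩G⊆S inv _ _ Gb c)
    S-avoids-b : ∀ {x y} → S x y → ¬ SameEdge (x , y) b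
    S-avoids-b s se = ¬Sb (resp-SameEdge (IsTree.sym tS) (SameEdge-sym se) s)
    inv′ : Invariant G′ (suc (toℕ i))
    inv′ = record
      { tree    = tree′
      ; C∩G⊆S   = λ { x y (inj₁ g , _) c → C∩G⊆S inv x y g c
                    ; x y (inj₂ se , _) _ → resp-SameEdge (IsTree.sym tS) se s }
      ; S∖C⊆G   = λ x y s′ ¬c → inj₁ (S∖C⊆G inv x y s′ ¬c) , S-avoids-b s′
      ; settled = extend-settled i (λ j j<i s′ → inj₁ (settled inv j j<i s′) , S-avoids-b s′)
                                   (λ s′ → inj₂ SameEdge-refl , S-avoids-b s′)
      }
    found : Reaches G′ (suc (toℕ i)) → Reaches G (toℕ i)
    found (inj₁ G′≐S)                   = inj₂ (G′ , i , ≤-refl , out b b-on-cycle ¬Cb , G′≐S)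
    found (inj₂ (X , j , i<j , run , X≐S)) =
      inj₂ (X , i , ≤-refl , rec b b-on-cycle ¬Cb j i<j run , X≐S)

  sweep : ∀ r {t} → r + t ≡ p → ∀ {G} → Invariant G t → Reaches G t
  sweep zero    refl inv = inj₁ (G≐S-at-end inv)
  sweep (suc r) {t} r+t≡p inv =
    let _ , inv′ , back = advance inv (fromℕ< t<p) (Finₚ.toℕ-fromℕ< t<p)
    in  back (sweep r (trans (+-suc r t) r+t≡p) inv′)
    where
    t<p : t < p
    t<p = subst (t <_) r+t≡p (s≤s (m≤n+m t r))

theorem4 : ∀ {n p} (𝓗 : Halin n p) (ord : Fin p → Fin p) → Bijective _≡_ _≡_ ord →
    ∀ (S : EdgeSet n) → SpanningTree (Halin.H 𝓗) S →
    ∃ λ X → Procedure.PLISTOut 𝓗 ord X × X ≐ S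
theorem4 {p = p} 𝓗 ord bij S (S⊆H , tS) = output (sweep p (+-identityʳ p) start)
  where
  open Sweep 𝓗 ord (proj₂ bij) S⊆H tS
  output : Reaches (Halin.T 𝓗) 0 → ∃ λ X → Procedure.PLISTOut 𝓗 ord X × X ≐ S
  output (inj₁ T≐S)                     = Halin.T 𝓗 , inj₁ refl , T≐S
  output (inj₂ (X , i , _ , run , X≐S)) = X , inj₂ (i , run) , X≐S
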